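{- Let $t$ be a positive integer and let $\Gamma$ be a graph which is a vertex-disjoint union of cliques. Let $A_\Gamma$ be the subgraph consisting of the clique components of $\Gamma$ with fewer than $t$ vertices, and $B_\Gamma$ the subgraph consisting of the components with at least $t$ vertices (so $\Gamma = A_\Gamma + B_\Gamma$). Let $c(B_\Gamma)$ denote the number of connected components of $B_\Gamma$. Then: (a) the largest (in number of vertices) induced subgraph of $\Gamma$ containing no clique on $t$ vertices has exactly $(t-1)c(B_\Gamma) + |V(A_\Gamma)|$ vertices; (b) if moreover $\Gamma$ is an $(n,k,t)$-graph (for positive integers $n \geq k \geq t$), then $k - 1 \geq (t-1)c(B_\Gamma) + |V(A_\Gamma)|$; (c) if furthermore $\Gamma$ is not an $(n,k-1,t)$-graph, then $k - 1 = (t-1)c(B_\Gamma) + |V(A_\Gamma)|$.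
   Context: A graph $G$ is an $(n,k,t)$-graph if $|V(G)| = n$ and every induced subgraph of $G$ on $k$ vertices contains a clique on $t$ vertices. A disjoint union of cliques may include cliques on one vertex. -}

module Defs where

open import Data.Nat using (ℕ; zero; suc; _+_; _*_; _∸_; _≤_; _<_; _<ᵇ_; _≤ᵇ_)
open import Data.Fin using (Fin; toℕ; _≟_)
import Data.Fin as F
open import Data.Bool using (Bool; true; false; _∨_; _∧_; not; if_then_else_)
open import Data.Product using (Σ; _×_; _,_)
open import Data.Fin.Subset using (Subset; _∈_; _⊆_; ∣_∣)
open import Relation.Binary.PropositionalEquality using (_≡_; _≢_)
open import Relation.Nullary using (¬_)
open import Relation.Nullary.Decidable using (⌊_⌋)

record Graph (n : ℕ) : Set where
  field
    adj    : Fin n → Fin n → Bool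
    sym    : ∀ u v → adj u v ≡ adj v u
    irrefl : ∀ v → adj v v ≡ false
open Graph public

-- Γ is a vertex-disjoint union of cliques (cliques on one vertex allowed):
-- adjacency among distinct vertices is transitive, i.e. every connected
-- component is a clique.
IsUnionOfCliques : ∀ {n} → Graph n → Set
IsUnionOfCliques {n} G =
  ∀ (u v w : Fin n) → adj G u v ≡ true → adj G v w ≡ true → u ≢ w → adj G u w ≡ true

IsClique : ∀ {n} → Graph n → Subset n → Set
IsClique {n} G T = ∀ (u v : Fin n) → u ∈ T → v ∈ T → u ≢ v → adj G u v ≡ true

HasCliqueIn : ∀ {n} → Graph n → ℕ → Subset n → Set
HasCliqueIn {n} G t S = Σ (Subset n) λ T → (T ⊆ S) × (∣ T ∣ ≡ t) × IsClique G T

IsNKT : ∀ {n} → Graph n → ℕ → ℕ → Set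
IsNKT {n} G k t = ∀ (S : Subset n) → ∣ S ∣ ≡ k → HasCliqueIn G t S

MaxCliqueFreeSize : ∀ {n} → Graph n → ℕ → ℕ → Set
MaxCliqueFreeSize {n} G t m =
  (Σ (Subset n) λ S → (∣ S ∣ ≡ m) × ¬ HasCliqueIn G t S)
  × (∀ (S : Subset n) → ¬ HasCliqueIn G t S → ∣ S ∣ ≤ m)

countFin : ∀ {n} → (Fin n → Bool) → ℕ
countFin {zero}  p = 0
countFin {suc n} p = (if p F.zero then 1 else 0) + countFin (λ i → p (F.suc i))

anyFin : ∀ {n} → (Fin n → Bool) → Bool
anyFin {zero}  p = false
anyFin {suc n} p = p F.zero ∨ anyFin (λ i → p (F.suc i))

-- u lies in the connected component (= clique) of v
sameComp : ∀ {n} → Graph n → Fin n → Fin n → Bool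
sameComp G u v = ⌊ u ≟ v ⌋ ∨ adj G u v

compSize : ∀ {n} → Graph n → Fin n → ℕ
compSize G v = countFin (λ u → sameComp G u v)

-- v is the least-indexed vertex of its component (one representative per component)
isRep : ∀ {n} → Graph n → Fin n → Bool
isRep G v = not (anyFin (λ u → (toℕ u <ᵇ toℕ v) ∧ adj G u v))

sizeA : ∀ {n} → Graph n → ℕ → ℕ
sizeA G t = countFin (λ v → compSize G v <ᵇ t)

compB : ∀ {n} → Graph n → ℕ → ℕ
compB G t = countFin (λ v → isRep G v ∧ (t ≤ᵇ compSize G v))

-- Within a union of cliques a vertex set contains a t-clique exactly when it meets some
-- component in at least t vertices.  Keeping the t − 1 lowest-indexed vertices of every
-- component therefore gives a t-clique-free set of size Σ_C min(t − 1, |C|), which is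
-- (t − 1) c(B) + |V(A)|, and every larger set meets some component in t vertices.  Hence
-- Γ is an (n,k,t)-graph exactly when k exceeds that size, which gives (b) and (c).
module Submission where

open import Defs hiding (sym)
open import Data.Nat.Properties hiding (_≟_)
open import Algebra.Properties.Semiring.Sum +-*-semiring
  using (sum-syntax; sum-cong-≗; ∑-distrib-+; ∑-comm; *-distribˡ-sum; *-distribʳ-sum)
open import Data.Bool using (Bool; true; false; _∧_; not; if_then_else_)
open import Data.Bool.Properties using (∧-comm; ∧-identityʳ; ∧-zeroʳ; ⇔→≡)
open import Data.Fin using (Fin; zero; suc; toℕ; _≟_)
open import Data.Fin.Properties using (¬∀⟶∃¬)
open import Data.Fin.Subset using (Subset; _∈_; _⊆_; ∣_∣; ⊥; inside; outside)
open import Data.Fin.Subset.Properties using (∉⊥; ∣⊥∣≡0)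
open import Data.Nat using (ℕ; zero; suc; _+_; _*_; _∸_; _≤_; _<_; _≥_; _<ᵇ_; _⊓_; z≤n; s≤s; _≤?_)
open import Data.Product using (Σ-syntax; _×_; _,_; proj₁; proj₂)
open import Data.Sum using (_⊎_; inj₁; inj₂)
open import Data.Vec using ([]; _∷_; lookup; tabulate; here; there)
open import Data.Vec.Properties using ([]=⇒lookup; lookup⇒[]=; lookup∘tabulate)
open import Function using (_∘_)
open import Function.Bundles using (mk⇔)
open import Relation.Binary.PropositionalEquality
open import Relation.Nullary using (¬_; yes; no; contradiction)
open import Relation.Nullary.Reflects using (ofʸ; ofⁿ)

𝟙 : Bool → ℕ
𝟙 b = if b then 1 else 0

𝟙-∧ : ∀ a b → 𝟙 (a ∧ b) ≡ 𝟙 a * 𝟙 b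
𝟙-∧ false b = refl
𝟙-∧ true  b = sym (+-identityʳ (𝟙 b))

∧-true⁺ : ∀ {a b} → a ≡ true → b ≡ true → (a ∧ b) ≡ true
∧-true⁺ refl refl = refl

∧-true⁻ : ∀ {a b} → (a ∧ b) ≡ true → a ≡ true × b ≡ true
∧-true⁻ {true} b≡true = refl , b≡true

∧-congˡ-true : ∀ a {b c} → (a ≡ true → b ≡ c) → (a ∧ b) ≡ (a ∧ c)
∧-congˡ-true true  b≡c = b≡c refl
∧-congˡ-true false b≡c = refl

∑-mono-≤ : ∀ {n} {f g : Fin n → ℕ} → (∀ i → f i ≤ g i) → ∑[ i < n ] f i ≤ ∑[ i < n ] g i
∑-mono-≤ {zero}  f≤g = z≤n
∑-mono-≤ {suc n} f≤g = +-mono-≤ (f≤g zero) (∑-mono-≤ (f≤g ∘ suc))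

m*[m<n]+n*[n≤m]≡m⊓n : ∀ j c → j * 𝟙 (j <ᵇ c) + c * 𝟙 (c <ᵇ suc j) ≡ j ⊓ c
m*[m<n]+n*[n≤m]≡m⊓n j c with j <ᵇ c | <ᵇ-reflects-< j c | c <ᵇ suc j | <ᵇ-reflects-< c (suc j)
... | true  | ofʸ j<c | true  | ofʸ c≤j = contradiction c≤j (<⇒≱ (s≤s j<c))
... | true  | ofʸ j<c | false | _       =
  trans (cong₂ _+_ (*-identityʳ j) (*-zeroʳ c)) (trans (+-identityʳ j) (sym (m≤n⇒m⊓n≡m (<⇒≤ j<c))))
... | false | ofⁿ j≮c | true  | _       =
  trans (cong (_+ c * 1) (*-zeroʳ j)) (trans (*-identityʳ c) (sym (m≥n⇒m⊓n≡n (≮⇒≥ j≮c))))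
... | false | ofⁿ j≮c | false | ofⁿ c≰j = contradiction (s≤s (≮⇒≥ j≮c)) c≰j

countFin≡∑ : ∀ {n} (p : Fin n → Bool) → countFin p ≡ ∑[ i < n ] 𝟙 (p i)
countFin≡∑ {zero}  p = refl
countFin≡∑ {suc n} p = cong (𝟙 (p zero) +_) (countFin≡∑ (p ∘ suc))

countFin-cong : ∀ {n} {p q : Fin n → Bool} → (∀ i → p i ≡ q i) → countFin p ≡ countFin q
countFin-cong {zero}  p≗q = refl
countFin-cong {suc n} p≗q = cong₂ _+_ (cong 𝟙 (p≗q zero)) (countFin-cong (p≗q ∘ suc))

countFin-mono : ∀ {n} {p q : Fin n → Bool} → (∀ i → p i ≡ true → q i ≡ true) →
                countFin p ≤ countFin q
countFin-mono {zero}                  p⇒q = z≤n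
countFin-mono {suc n} {p} {q} p⇒q with p zero in p₀ | q zero in q₀
... | false | _     = ≤-trans (countFin-mono (p⇒q ∘ suc)) (m≤n+m _ _)
... | true  | true  = s≤s (countFin-mono (p⇒q ∘ suc))
... | true  | false with () ← trans (sym (p⇒q zero p₀)) q₀

countFin-false : ∀ {n} {p : Fin n → Bool} → (∀ i → p i ≡ false) → countFin p ≡ 0
countFin-false {zero}      p≡false = refl
countFin-false {suc n} {p} p≡false rewrite p≡false zero = countFin-false (p≡false ∘ suc)

countFin-∧ʳ : ∀ {n} (p : Fin n → Bool) b → countFin (λ i → p i ∧ b) ≡ countFin p * 𝟙 b
countFin-∧ʳ p true  = trans (countFin-cong (λ i → ∧-identityʳ (p i))) (sym (*-identityʳ _))
countFin-∧ʳ p false = trans (countFin-false (λ i → ∧-zeroʳ (p i))) (sym (*-zeroʳ (countFin p)))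

countFin-pos : ∀ {n} {p : Fin n → Bool} i → p i ≡ true → 0 < countFin p
countFin-pos           zero    pᵢ rewrite pᵢ = s≤s z≤n
countFin-pos {p = p} (suc i) pᵢ = ≤-trans (countFin-pos {p = p ∘ suc} i pᵢ) (m≤n+m _ _)

countFin-witness : ∀ {n} (p : Fin n → Bool) → 0 < countFin p → Σ[ i ∈ Fin n ] p i ≡ true
countFin-witness {suc n} p pos with p zero in p₀
... | true  = zero , p₀
... | false = let i , pᵢ = countFin-witness (p ∘ suc) pos in suc i , pᵢ

not-anyFin : ∀ {n} (p : Fin n → Bool) → not (anyFin p) ≡ (countFin p <ᵇ 1)
not-anyFin {zero}  p = refl
not-anyFin {suc n} p with p zero
... | true  = refl
... | false = not-anyFin (p ∘ suc)

∣∣≡countFin : ∀ {n} (S : Subset n) → ∣ S ∣ ≡ countFin (lookup S)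
∣∣≡countFin []          = refl
∣∣≡countFin (true ∷ S)  = cong suc (∣∣≡countFin S)
∣∣≡countFin (false ∷ S) = ∣∣≡countFin S

subsetOfSize : ∀ {n} (p : Fin n → Bool) {k} → k ≤ countFin p →
               Σ[ T ∈ Subset n ] (∀ {i} → i ∈ T → p i ≡ true) × ∣ T ∣ ≡ k
subsetOfSize {zero} p z≤n = [] , (λ ()) , refl
subsetOfSize {suc n} p k≤ with p zero in p₀
... | false = let T , T⊆p , ∣T∣ = subsetOfSize (p ∘ suc) k≤ in
  outside ∷ T , (λ { (there i∈T) → T⊆p i∈T }) , ∣T∣
subsetOfSize {suc n} p {zero} k≤ | true = ⊥ , (λ i∈⊥ → contradiction i∈⊥ ∉⊥) , ∣⊥∣≡0 (suc n)
subsetOfSize {suc n} p {suc k} (s≤s k≤) | true = let T , T⊆p , ∣T∣ = subsetOfSize (p ∘ suc) k≤ in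
  inside ∷ T , (λ { here → p₀ ; (there i∈T) → T⊆p i∈T }) , cong suc ∣T∣

rankIn : ∀ {n} → (Fin n → Bool) → Fin n → ℕ
rankIn p v = countFin (λ u → p u ∧ (toℕ u <ᵇ toℕ v))

rankIn-zero : ∀ {n} (p : Fin (suc n) → Bool) → rankIn p zero ≡ 0
rankIn-zero p = countFin-false (λ u → ∧-zeroʳ (p u))

rankIn-suc : ∀ {n} (p : Fin (suc n) → Bool) v → rankIn p (suc v) ≡ 𝟙 (p zero) + rankIn (p ∘ suc) v
rankIn-suc p v = cong (λ b → 𝟙 b + rankIn (p ∘ suc) v) (∧-identityʳ (p zero))

countFin-rankIn< : ∀ {n} (p : Fin n → Bool) j →
                   countFin (λ v → p v ∧ (rankIn p v <ᵇ j)) ≡ j ⊓ countFin p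
countFin-rankIn< {zero}  p j = sym (⊓-zeroʳ j)
countFin-rankIn< {suc n} p j = begin
  𝟙 (p zero ∧ (rankIn p zero <ᵇ j)) + countFin (λ v → p (suc v) ∧ (rankIn p (suc v) <ᵇ j))
    ≡⟨ cong₂ _+_ (cong (λ r → 𝟙 (p zero ∧ (r <ᵇ j))) (rankIn-zero p))
                 (countFin-cong (λ v → cong (λ r → p (suc v) ∧ (r <ᵇ j)) (rankIn-suc p v))) ⟩
  𝟙 (p zero ∧ (0 <ᵇ j)) + countFin (λ v → p (suc v) ∧ ((𝟙 (p zero) + rankIn (p ∘ suc) v) <ᵇ j))
    ≡⟨ shift (p zero) j ⟩
  j ⊓ countFin p ∎
  where
  open ≡-Reasoning
  shift : ∀ b j → 𝟙 (b ∧ (0 <ᵇ j)) + countFin (λ v → p (suc v) ∧ ((𝟙 b + rankIn (p ∘ suc) v) <ᵇ j))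
                  ≡ j ⊓ (𝟙 b + countFin (p ∘ suc))
  shift false j       = countFin-rankIn< (p ∘ suc) j
  shift true  zero    = countFin-false (λ v → ∧-zeroʳ (p (suc v)))
  shift true  (suc j) = cong suc (countFin-rankIn< (p ∘ suc) j)

-- MaxCliqueFreeSize only bounds clique-free sets, which constructively gives ¬ ¬ HasCliqueIn
-- for larger sets; here larger sets come with their clique.
record CliqueThreshold {n} (G : Graph n) (t m : ℕ) : Set where
  field
    witness        : Subset n
    ∣witness∣      : ∣ witness ∣ ≡ m
    witness-free   : ¬ HasCliqueIn G t witness
    large⇒clique   : ∀ S → m < ∣ S ∣ → HasCliqueIn G t S

module _ {n} {G : Graph n} {t m : ℕ} (th : CliqueThreshold G t m) where
  open CliqueThreshold th

  threshold⇒maxCliqueFreeSize : MaxCliqueFreeSize G t m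
  threshold⇒maxCliqueFreeSize = (witness , ∣witness∣ , witness-free) , small
    where
    small : ∀ S → ¬ HasCliqueIn G t S → ∣ S ∣ ≤ m
    small S free with ∣ S ∣ ≤? m
    ... | yes ∣S∣≤m = ∣S∣≤m
    ... | no  ∣S∣≰m = contradiction (large⇒clique S (≰⇒> ∣S∣≰m)) free

  isNKT⇒threshold< : ∀ {k} → IsNKT G k t → m < k
  isNKT⇒threshold< {k} nkt = ≰⇒> k≰m
    where
    m≡count : m ≡ countFin (lookup witness)
    m≡count = trans (sym ∣witness∣) (∣∣≡countFin witness)
    k≰m : ¬ k ≤ m
    k≰m k≤m with subsetOfSize (lookup witness) (subst (k ≤_) m≡count k≤m)
    ... | T , T⊆witness , ∣T∣ with nkt T ∣T∣
    ...   | C , C⊆T , ∣C∣ , C-clique =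
      witness-free (C , (λ {i} i∈C → lookup⇒[]= i witness (T⊆witness (C⊆T i∈C))) , ∣C∣ , C-clique)

  threshold<⇒isNKT : ∀ {k} → m < k → IsNKT G k t
  threshold<⇒isNKT m<k S ∣S∣≡k = large⇒clique S (subst (m <_) (sym ∣S∣≡k) m<k)

module UnionOfCliques {n} (G : Graph n) (cliques : IsUnionOfCliques G) where

  sameComp-intro : ∀ {u v} → (u ≢ v → adj G u v ≡ true) → sameComp G u v ≡ true
  sameComp-intro {u} {v} adjacentIfDistinct with u ≟ v
  ... | yes _   = refl
  ... | no  u≢v = adjacentIfDistinct u≢v

  sameComp-elim : ∀ {u v} → sameComp G u v ≡ true → u ≡ v ⊎ adj G u v ≡ true
  sameComp-elim {u} {v} u~v with u ≟ v
  ... | yes u≡v = inj₁ u≡v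
  ... | no  _   = inj₂ u~v

  sameComp-refl : ∀ v → sameComp G v v ≡ true
  sameComp-refl v = sameComp-intro (λ v≢v → contradiction refl v≢v)

  sameComp-sym : ∀ {u v} → sameComp G u v ≡ true → sameComp G v u ≡ true
  sameComp-sym u~v with sameComp-elim u~v
  ... | inj₁ refl = u~v
  ... | inj₂ uv   = sameComp-intro (λ _ → trans (Graph.sym G _ _) uv)

  sameComp-trans : ∀ {u v w} → sameComp G u v ≡ true → sameComp G v w ≡ true → sameComp G u w ≡ true
  sameComp-trans {u} {v} {w} u~v v~w with sameComp-elim u~v | sameComp-elim v~w
  ... | inj₁ refl | _         = v~w
  ... | inj₂ _    | inj₁ refl = u~v
  ... | inj₂ uv   | inj₂ vw   = sameComp-intro (cliques u v w uv vw)

  sameComp-comm : ∀ u v → sameComp G u v ≡ sameComp G v u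
  sameComp-comm u v = ⇔→≡ (mk⇔ sameComp-sym sameComp-sym)

  component : Fin n → Fin n → Bool
  component r u = sameComp G u r

  component-cong : ∀ {u r} → sameComp G u r ≡ true → ∀ w → component u w ≡ component r w
  component-cong u~r w =
    ⇔→≡ (mk⇔ (λ w~u → sameComp-trans w~u u~r) (λ w~r → sameComp-trans w~r (sameComp-sym u~r)))

  compSize-cong : ∀ {u r} → sameComp G u r ≡ true → compSize G u ≡ compSize G r
  compSize-cong u~r = countFin-cong (component-cong u~r)

  clique⇒sameComp : ∀ {T u v} → IsClique G T → u ∈ T → v ∈ T → sameComp G u v ≡ true
  clique⇒sameComp clique u∈T v∈T = sameComp-intro (clique _ _ u∈T v∈T)

  ⊆component⇒clique : ∀ {T r} → (∀ {u} → u ∈ T → component r u ≡ true) → IsClique G T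
  ⊆component⇒clique T⊆r u v u∈T v∈T u≢v
    with sameComp-elim (sameComp-trans (T⊆r u∈T) (sameComp-sym (T⊆r v∈T)))
  ... | inj₁ u≡v = contradiction u≡v u≢v
  ... | inj₂ uv  = uv

  rank : Fin n → ℕ
  rank v = rankIn (component v) v

  rank-cong : ∀ {u r} → sameComp G u r ≡ true → rank u ≡ rankIn (component r) u
  rank-cong u~r = countFin-cong (λ w → cong (_∧ _) (component-cong u~r w))

  isRep≡rank<1 : ∀ r → isRep G r ≡ (rank r <ᵇ 1)
  isRep≡rank<1 r = trans (not-anyFin {n} _)
                         (cong (_<ᵇ 1) (countFin-cong earlier))
    where
    earlier : ∀ u → ((toℕ u <ᵇ toℕ r) ∧ adj G u r) ≡ (sameComp G u r ∧ (toℕ u <ᵇ toℕ r))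
    earlier u with u ≟ r
    ... | no  _    = ∧-comm (toℕ u <ᵇ toℕ r) (adj G u r)
    ... | yes refl with toℕ u <ᵇ toℕ u | <ᵇ-reflects-< (toℕ u) (toℕ u)
    ...   | true  | ofʸ u<u = contradiction u<u (<-irrefl refl)
    ...   | false | _       = refl

  repOf-unique : ∀ u → ∑[ r < n ] (𝟙 (isRep G r) * 𝟙 (component r u)) ≡ 1
  repOf-unique u = begin
    ∑[ r < n ] (𝟙 (isRep G r) * 𝟙 (component r u))
      ≡⟨ sum-cong-≗ repIndicator ⟩
    ∑[ r < n ] 𝟙 (component u r ∧ (rankIn (component u) r <ᵇ 1))
      ≡⟨ sym (countFin≡∑ {n} _) ⟩
    countFin (λ r → component u r ∧ (rankIn (component u) r <ᵇ 1))
      ≡⟨ countFin-rankIn< (component u) 1 ⟩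
    1 ⊓ compSize G u
      ≡⟨ m≤n⇒m⊓n≡m (countFin-pos u (sameComp-refl u)) ⟩
    1 ∎
    where
    open ≡-Reasoning
    repIndicator : ∀ r → 𝟙 (isRep G r) * 𝟙 (component r u)
                         ≡ 𝟙 (component u r ∧ (rankIn (component u) r <ᵇ 1))
    repIndicator r rewrite sameComp-comm u r with sameComp G r u in r~u
    ... | false = *-zeroʳ (𝟙 (isRep G r))
    ... | true  = trans (*-identityʳ (𝟙 (isRep G r)))
                        (cong 𝟙 (trans (isRep≡rank<1 r) (cong (_<ᵇ 1) (rank-cong r~u))))

  countFin-byComponent : ∀ (p : Fin n → Bool) →
    countFin p ≡ ∑[ r < n ] (𝟙 (isRep G r) * countFin (λ u → component r u ∧ p u))
  countFin-byComponent p = begin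
    countFin p
      ≡⟨ countFin≡∑ p ⟩
    ∑[ u < n ] 𝟙 (p u)
      ≡⟨ sum-cong-≗ (λ u → sym (trans (cong (_* 𝟙 (p u)) (repOf-unique u)) (*-identityˡ _))) ⟩
    ∑[ u < n ] (∑[ r < n ] (𝟙 (isRep G r) * 𝟙 (component r u)) * 𝟙 (p u))
      ≡⟨ sum-cong-≗ (λ u → *-distribʳ-sum {n} (𝟙 (p u)) _) ⟩
    ∑[ u < n ] ∑[ r < n ] (𝟙 (isRep G r) * 𝟙 (component r u) * 𝟙 (p u))
      ≡⟨ ∑-comm {n} {n} _ ⟩
    ∑[ r < n ] ∑[ u < n ] (𝟙 (isRep G r) * 𝟙 (component r u) * 𝟙 (p u))
      ≡⟨ sum-cong-≗ (λ r → sum-cong-≗ (λ u →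
           trans (*-assoc (𝟙 (isRep G r)) _ _)
                 (cong (𝟙 (isRep G r) *_) (sym (𝟙-∧ (component r u) (p u)))))) ⟩
    ∑[ r < n ] ∑[ u < n ] (𝟙 (isRep G r) * 𝟙 (component r u ∧ p u))
      ≡⟨ sum-cong-≗ (λ r → sym (trans (cong (𝟙 (isRep G r) *_) (countFin≡∑ {n} _))
                                       (*-distribˡ-sum {n} (𝟙 (isRep G r)) _))) ⟩
    ∑[ r < n ] (𝟙 (isRep G r) * countFin (λ u → component r u ∧ p u)) ∎
    where open ≡-Reasoning

  meet : Subset n → Fin n → ℕ
  meet S r = countFin (λ u → component r u ∧ lookup S u)

  ∣∣≡∑meet : ∀ S → ∣ S ∣ ≡ ∑[ r < n ] (𝟙 (isRep G r) * meet S r)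
  ∣∣≡∑meet S = trans (∣∣≡countFin S) (countFin-byComponent (lookup S))

  meet≤compSize : ∀ S r → meet S r ≤ compSize G r
  meet≤compSize S r = countFin-mono {n} (λ u → proj₁ ∘ ∧-true⁻)

  clique≤meet : ∀ {S T v} → T ⊆ S → IsClique G T → v ∈ T → ∣ T ∣ ≤ meet S v
  clique≤meet {S} {T} {v} T⊆S clique v∈T = begin
    ∣ T ∣                ≡⟨ ∣∣≡countFin T ⟩
    countFin (lookup T)  ≤⟨ countFin-mono {n} inMeet ⟩
    meet S v             ∎
    where
    open ≤-Reasoning
    inMeet : ∀ u → lookup T u ≡ true → (component v u ∧ lookup S u) ≡ true
    inMeet u u∈T = ∧-true⁺ (clique⇒sameComp clique (lookup⇒[]= u T u∈T) v∈T)
                           ([]=⇒lookup (T⊆S (lookup⇒[]= u T u∈T)))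

  lowest : ℕ → Subset n
  lowest j = tabulate (λ v → rank v <ᵇ j)

  meet-lowest : ∀ j r → meet (lowest j) r ≡ j ⊓ compSize G r
  meet-lowest j r = trans (countFin-cong {n} lowerRank) (countFin-rankIn< (component r) j)
    where
    lowerRank : ∀ u → (component r u ∧ lookup (lowest j) u)
                      ≡ (component r u ∧ (rankIn (component r) u <ᵇ j))
    lowerRank u = ∧-congˡ-true (component r u)
      (λ u~r → trans (lookup∘tabulate (λ v → rank v <ᵇ j) u) (cong (_<ᵇ j) (rank-cong u~r)))

  lowest-cliqueFree : ∀ j → ¬ HasCliqueIn G (suc j) (lowest j)
  lowest-cliqueFree j (T , T⊆lowest , ∣T∣ , clique)
    with countFin-witness (lookup T) (subst (0 <_) (trans (sym ∣T∣) (∣∣≡countFin T)) (s≤s z≤n))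
  ... | v , v∈T = <-irrefl refl (begin
    suc j                  ≡⟨ sym ∣T∣ ⟩
    ∣ T ∣                  ≤⟨ clique≤meet T⊆lowest clique (lookup⇒[]= v T v∈T) ⟩
    meet (lowest j) v      ≡⟨ meet-lowest j v ⟩
    j ⊓ compSize G v       ≤⟨ m⊓n≤m j (compSize G v) ⟩
    j                      ∎)
    where open ≤-Reasoning

  cliqueFreeSize : ℕ → ℕ
  cliqueFreeSize j = ∑[ r < n ] (𝟙 (isRep G r) * (j ⊓ compSize G r))

  ∣lowest∣ : ∀ j → ∣ lowest j ∣ ≡ cliqueFreeSize j
  ∣lowest∣ j = trans (∣∣≡∑meet (lowest j))
                     (sum-cong-≗ (λ r → cong (𝟙 (isRep G r) *_) (meet-lowest j r)))

  large⇒clique : ∀ j S → cliqueFreeSize j < ∣ S ∣ → HasCliqueIn G (suc j) S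
  large⇒clique j S large with ¬∀⟶∃¬ n (λ r → meet S r ≤ j) (λ r → meet S r ≤? j) smallMeets
    where
    smallMeets : ¬ (∀ r → meet S r ≤ j)
    smallMeets meet≤j = <⇒≱ large (begin
      ∣ S ∣                                         ≡⟨ ∣∣≡∑meet S ⟩
      ∑[ r < n ] (𝟙 (isRep G r) * meet S r)        ≤⟨ ∑-mono-≤ (λ r → *-monoʳ-≤ (𝟙 (isRep G r))
                                                         (⊓-glb (meet≤j r) (meet≤compSize S r))) ⟩
      cliqueFreeSize j                             ∎)
      where open ≤-Reasoning
  ... | r , meet≰j with subsetOfSize (λ u → component r u ∧ lookup S u) (≰⇒> meet≰j)
  ...   | T , T⊆meet , ∣T∣ =
    T , (λ {u} u∈T → lookup⇒[]= u S (proj₂ (∧-true⁻ (T⊆meet u∈T)))) , ∣T∣ ,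
    ⊆component⇒clique (proj₁ ∘ ∧-true⁻ ∘ T⊆meet)

  threshold : ∀ j → CliqueThreshold G (suc j) (cliqueFreeSize j)
  threshold j = record
    { witness      = lowest j
    ; ∣witness∣    = ∣lowest∣ j
    ; witness-free = lowest-cliqueFree j
    ; large⇒clique = large⇒clique j
    }

  cliqueFreeSize≡ : ∀ j → j * compB G (suc j) + sizeA G (suc j) ≡ cliqueFreeSize j
  cliqueFreeSize≡ j = begin
    j * compB G (suc j) + sizeA G (suc j)
      ≡⟨ cong₂ _+_ compB≡ sizeA≡ ⟩
    ∑[ r < n ] (j * (𝟙 (isRep G r) * 𝟙 (j <ᵇ compSize G r)))
      + ∑[ r < n ] (𝟙 (isRep G r) * (compSize G r * 𝟙 (compSize G r <ᵇ suc j)))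
      ≡⟨ sym (∑-distrib-+ {n} _ _) ⟩
    ∑[ r < n ] (j * (𝟙 (isRep G r) * 𝟙 (j <ᵇ compSize G r))
                 + 𝟙 (isRep G r) * (compSize G r * 𝟙 (compSize G r <ᵇ suc j)))
      ≡⟨ sum-cong-≗ (λ r → perComponent (isRep G r) (compSize G r)) ⟩
    cliqueFreeSize j ∎
    where
    open ≡-Reasoning
    compB≡ : j * compB G (suc j) ≡ ∑[ r < n ] (j * (𝟙 (isRep G r) * 𝟙 (j <ᵇ compSize G r)))
    compB≡ = trans (cong (j *_) (trans (countFin≡∑ (λ r → isRep G r ∧ (j <ᵇ compSize G r)))
                                       (sum-cong-≗ (λ r → 𝟙-∧ (isRep G r) (j <ᵇ compSize G r)))))
                   (*-distribˡ-sum {n} j _)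
    sizeA≡ : sizeA G (suc j)
             ≡ ∑[ r < n ] (𝟙 (isRep G r) * (compSize G r * 𝟙 (compSize G r <ᵇ suc j)))
    sizeA≡ = trans (countFin-byComponent (λ u → compSize G u <ᵇ suc j))
                   (sum-cong-≗ (λ r → cong (𝟙 (isRep G r) *_) (sizeOfSmall r)))
      where
      sizeOfSmall : ∀ r → countFin (λ u → component r u ∧ (compSize G u <ᵇ suc j))
                          ≡ compSize G r * 𝟙 (compSize G r <ᵇ suc j)
      sizeOfSmall r = trans (countFin-cong {n} (λ u → ∧-congˡ-true (component r u)
                                                         (cong (_<ᵇ suc j) ∘ compSize-cong)))
                            (countFin-∧ʳ (component r) (compSize G r <ᵇ suc j))
    perComponent : ∀ a c → j * (𝟙 a * 𝟙 (j <ᵇ c)) + 𝟙 a * (c * 𝟙 (c <ᵇ suc j)) ≡ 𝟙 a * (j ⊓ c)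
    perComponent false c = trans (+-identityʳ (j * 0)) (*-zeroʳ j)
    perComponent true  c = trans (cong₂ _+_ (cong (j *_) (*-identityˡ _)) (*-identityˡ _))
                                 (trans (m*[m<n]+n*[n≤m]≡m⊓n j c) (sym (*-identityˡ (j ⊓ c))))

lemma4 : ∀ (n t : ℕ) (G : Graph n) → 1 ≤ t → IsUnionOfCliques G →
    MaxCliqueFreeSize G t ((t ∸ 1) * compB G t + sizeA G t)
    × (∀ (k : ℕ) → t ≤ k → k ≤ n → IsNKT G k t →
        (k ∸ 1 ≥ (t ∸ 1) * compB G t + sizeA G t)
        × (¬ IsNKT G (k ∸ 1) t → k ∸ 1 ≡ (t ∸ 1) * compB G t + sizeA G t))
lemma4 n zero    G () _
lemma4 n (suc j) G _ cliques =
  threshold⇒maxCliqueFreeSize th ,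
  λ k _ _ nkt → let k∸1≥m = suc[m]≤n⇒m≤pred[n] (isNKT⇒threshold< th nkt) in
    k∸1≥m , λ ¬nkt → ≤-antisym (≮⇒≥ (¬nkt ∘ threshold<⇒isNKT th)) k∸1≥m
  where
  open UnionOfCliques G cliques
  th : CliqueThreshold G (suc j) (j * compB G (suc j) + sizeA G (suc j))
  th = subst (CliqueThreshold G (suc j)) (sym (cliqueFreeSize≡ j)) (threshold j)
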